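{- Let $n \geq 2$ and suppose the following holds in $\mathbb{F}_2^{n-1}$: for any nonzero vectors $x_1, \dots, x_{2^{n-2}} \in \mathbb{F}_2^{n-1}$ with $\sum_i x_i = 0$, there exist vectors $p_1', q_1', \dots, p_{2^{n-2}}', q_{2^{n-2}}'$ forming exactly the $2^{n-1}$ elements of $\mathbb{F}_2^{n-1}$ (each once) with $p_i' + q_i' = x_i$ for all $i$. Then for any nonzero vectors $v_1, \dots, v_{2^{n-1}} \in \mathbb{F}_2^n$ with $v_{2i-1} = v_{2i}$ for all $1 \leq i \leq 2^{n-2}$, there exist vectors $p_1, q_1, \dots, p_{2^{n-1}}, q_{2^{n-1}}$ forming exactly the $2^n$ elements of $\mathbb{F}_2^n$ (each once) with $p_i + q_i = v_i$ for all $1 \leq i \leq 2^{n-1}$. -}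

module Defs where

open import Data.Bool using (Bool; false; _xor_)
open import Data.Nat using (ℕ; zero; suc)
open import Data.Fin using (Fin; zero; suc)
open import Data.Vec using (Vec; zipWith; replicate)
open import Data.Sum using (_⊎_; [_,_])
open import Data.Product using (∃₂; _×_)
open import Function.Definitions using (Bijective)
open import Relation.Binary.PropositionalEquality using (_≡_)

V : ℕ → Set
V m = Vec Bool m

_⊕_ : ∀ {m} → V m → V m → V m
_⊕_ = zipWith _xor_

infixl 6 _⊕_

𝟎 : ∀ {m} → V m
𝟎 {m} = replicate m false

ΣV : ∀ {m k} → (Fin k → V m) → V m
ΣV {k = zero}  x = 𝟎
ΣV {k = suc k} x = x zero ⊕ ΣV (λ i → x (suc i))

-- p₁,q₁,…,p_k,q_k form exactly the elements of 𝔽₂^m, each exactly once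
-- (the combined map Fin k ⊎ Fin k → 𝔽₂^m is a bijection) and pᵢ + qᵢ = xᵢ.
PairDecomposition : ∀ {m k} → (Fin k → V m) → Set
PairDecomposition {m} {k} x =
  ∃₂ λ (p q : Fin k → V m) →
    Bijective _≡_ _≡_ [ p , q ] × (∀ i → p i ⊕ q i ≡ x i)

-- Write v as pairs v₂ₜ = v₂ₜ₊₁ = Wₜ (t < K = 2^(n-2)), S = Σ Wₜ.  For a nonzero
-- direction e take a linear involution T (a transvection) with T e = u = (1,0,…,0);
-- π = tail ∘ T has kernel {0, e}.  From a decomposition of the reduced family
-- xₜ = π Wₜ + [Wₜ = e]·c in 𝔽₂^(n-1), the vectors (a, pₜ), (a, qₜ) regroup into two
-- pairs with sum T Wₜ ('double'); applying T and reindexing Fin K × Bool ≅ Fin 2K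
-- decomposes v ('reduction').  The hypothesis applies to x once x is nonzero with
-- Σ x = π S + par(e)·c = 0, par(e) being the parity of the multiplicity of e.  This
-- holds for suitable c as soon as par(e) = 1 exactly when S ∉ {0, e}; such an e
-- exists by a parity count over 𝔽₂^n, the xor of par(y) over all y being 0 since K
-- is even ('balanced-direction').  For n = 2 the hypothesis is vacuous and x is the
-- vector 1 ∈ 𝔽₂¹, decomposed directly as 0 + 1.
module Submission where

open import Defs
open import Algebra.Bundles using (CommutativeRing)
open import Data.Bool using (Bool; true; false; not; _∧_; _xor_)
open import Data.Bool.Properties
  using (xor-same; xor-assoc; xor-comm; xor-identityˡ; xor-identityʳ; ∧-identityʳ;
         ∧-distribʳ-xor; xor-annihilates-not; not-involutive; not-injective; xor-∧-commutativeRing)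
  renaming (_≟_ to _≟ᵇ_)
open import Algebra.Properties.CommutativeSemigroup
  (CommutativeRing.+-commutativeSemigroup xor-∧-commutativeRing)
  renaming (interchange to xor-interchange)
  using ()
open import Data.Empty using (⊥-elim)
open import Data.Fin using (Fin; zero; suc; toℕ; cast; combine)
open import Data.Fin.Properties using (*↔×; 2↔Bool; cast-involutive; toℕ-cast; toℕ-combine)
open import Data.Nat using (ℕ; zero; suc; _+_; _*_; _^_; _≤_; _∸_; z≤n; s≤s)
open import Data.Nat.Properties using (*-comm; +-identityʳ; +-comm)
open import Data.Product using (_×_; _,_; proj₁; proj₂; ∃; ∃₂)
open import Data.Product.Function.NonDependent.Propositional using (_×-↔_)
open import Data.Sum as Sum using (_⊎_; inj₁; inj₂; [_,_]; [_,_]′)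
open import Data.Sum.Function.Propositional using (_⊎-↔_)
open import Data.Vec using ([]; _∷_; head; tail)
open import Data.Vec.Properties using (≡-dec)
open import Data.Vec.Relation.Binary.Pointwise.Inductive
  using (Pointwise-≡⇒≡; zipWith-assoc; zipWith-identityˡ; zipWith-identityʳ)
open import Function.Bundles using (_↔_; Inverse; Bijection; mk↔ₛ′; mk⤖)
open import Function.Definitions using (Bijective)
open import Function.Properties.Bijection using (⤖⇒↔)
open import Function.Properties.Inverse using (↔-trans; ↔-refl; ↔⇒⤖)
open import Relation.Binary.Definitions using (DecidableEquality)
open import Relation.Binary.PropositionalEquality
  using (_≡_; _≢_; refl; sym; trans; cong; cong₂; module ≡-Reasoning)
open import Relation.Nullary using (does; yes; no)
open import Relation.Nullary.Decidable using (dec-true; dec-false)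

⊕-assoc : ∀ {m} (x y z : V m) → (x ⊕ y) ⊕ z ≡ x ⊕ (y ⊕ z)
⊕-assoc x y z = Pointwise-≡⇒≡ (zipWith-assoc xor-assoc x y z)

⊕-identityˡ : ∀ {m} (x : V m) → 𝟎 ⊕ x ≡ x
⊕-identityˡ x = Pointwise-≡⇒≡ (zipWith-identityˡ xor-identityˡ x)

⊕-identityʳ : ∀ {m} (x : V m) → x ⊕ 𝟎 ≡ x
⊕-identityʳ x = Pointwise-≡⇒≡ (zipWith-identityʳ xor-identityʳ x)

⊕-self : ∀ {m} (x : V m) → x ⊕ x ≡ 𝟎
⊕-self []      = refl
⊕-self (a ∷ x) = cong₂ _∷_ (xor-same a) (⊕-self x)

⊕-cancelˡ : ∀ {m} (x y : V m) → x ⊕ (x ⊕ y) ≡ y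
⊕-cancelˡ x y = trans (sym (⊕-assoc x x y)) (trans (cong (_⊕ y) (⊕-self x)) (⊕-identityˡ y))

⊕-interchange : ∀ {m} (w x y z : V m) → (w ⊕ x) ⊕ (y ⊕ z) ≡ (w ⊕ y) ⊕ (x ⊕ z)
⊕-interchange []      []      []      []      = refl
⊕-interchange (a ∷ w) (b ∷ x) (c ∷ y) (d ∷ z) =
  cong₂ _∷_ (xor-interchange a b c d) (⊕-interchange w x y z)

tail-⊕ : ∀ {m} (x y : V (suc m)) → tail (x ⊕ y) ≡ tail x ⊕ tail y
tail-⊕ (a ∷ x) (b ∷ y) = refl

unit : ∀ {k} → V (suc k)
unit = true ∷ 𝟎

tail≡𝟎 : ∀ {m} (x : V (suc m)) → tail x ≡ 𝟎 → x ≡ 𝟎 ⊎ x ≡ unit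
tail≡𝟎 (false ∷ x) refl = inj₁ refl
tail≡𝟎 (true ∷ x)  refl = inj₂ refl

head-∷-tail : ∀ {m} (x : V (suc m)) → head x ∷ tail x ≡ x
head-∷-tail (a ∷ x) = refl

infixr 7 _·_
_·_ : ∀ {m} → Bool → V m → V m
true  · x = x
false · x = 𝟎

·-xor : ∀ {m} (a b : Bool) (x : V m) → (a xor b) · x ≡ a · x ⊕ b · x
·-xor true  true  x = sym (⊕-self x)
·-xor true  false x = sym (⊕-identityʳ x)
·-xor false true  x = sym (⊕-identityˡ x)
·-xor false false x = sym (⊕-identityˡ 𝟎)

Linear : ∀ {m m′} → (V m → V m′) → Set
Linear f = ∀ x y → f (x ⊕ y) ≡ f x ⊕ f y

LinearFunctional : ∀ {m} → (V m → Bool) → Set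
LinearFunctional φ = ∀ x y → φ (x ⊕ y) ≡ φ x xor φ y

linear-𝟎 : ∀ {m m′} (f : V m → V m′) → Linear f → f 𝟎 ≡ 𝟎
linear-𝟎 f f-linear =
  trans (cong f (sym (⊕-self 𝟎))) (trans (f-linear 𝟎 𝟎) (⊕-self (f 𝟎)))

functional-𝟎 : ∀ {m} (φ : V m → Bool) → LinearFunctional φ → φ 𝟎 ≡ false
functional-𝟎 φ φ-linear =
  trans (cong φ (sym (⊕-self 𝟎))) (trans (φ-linear 𝟎 𝟎) (xor-same (φ 𝟎)))

_≟ⱽ_ : ∀ {m} → DecidableEquality (V m)
_≟ⱽ_ = ≡-dec _≟ᵇ_

infix 4 _==_
_==_ : ∀ {m} → V m → V m → Bool
x == y = does (x ≟ⱽ y)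

==-refl : ∀ {m} (x : V m) → (x == x) ≡ true
==-refl x = dec-true (x ≟ⱽ x) refl

==-false : ∀ {m} {x y : V m} → (x == y) ≡ false → x ≢ y
==-false {x = x} {y} eq with x ≟ⱽ y
... | no x≢y = x≢y

⨁ : ∀ {K} → (Fin K → Bool) → Bool
⨁ {zero}  f = false
⨁ {suc K} f = f zero xor ⨁ (λ t → f (suc t))

⨁-cong : ∀ {K} {f g : Fin K → Bool} → (∀ t → f t ≡ g t) → ⨁ f ≡ ⨁ g
⨁-cong {zero}  eq = refl
⨁-cong {suc K} eq = cong₂ _xor_ (eq zero) (⨁-cong (λ t → eq (suc t)))

⨁-false : ∀ {K} → ⨁ {K} (λ _ → false) ≡ false
⨁-false {zero}  = refl
⨁-false {suc K} = ⨁-false {K}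

⨁-∧ : ∀ {K} (f : Fin K → Bool) (b : Bool) → ⨁ (λ t → f t ∧ b) ≡ ⨁ f ∧ b
⨁-∧ {zero}  f b = refl
⨁-∧ {suc K} f b =
  trans (cong (f zero ∧ b xor_) (⨁-∧ (λ t → f (suc t)) b)) (sym (∧-distribʳ-xor b (f zero) _))

⨁-const-+ : ∀ a b (c : Bool) → ⨁ {a + b} (λ _ → c) ≡ ⨁ {a} (λ _ → c) xor ⨁ {b} (λ _ → c)
⨁-const-+ zero    b c = refl
⨁-const-+ (suc a) b c = trans (cong (c xor_) (⨁-const-+ a b c)) (sym (xor-assoc c _ _))

⨁-const-even : ∀ K (c : Bool) → ⨁ {2 * K} (λ _ → c) ≡ false
⨁-const-even K c = begin
  ⨁ {K + (K + 0)} (λ _ → c)  ≡⟨ ⨁-const-+ K (K + 0) c ⟩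
  X xor ⨁ {K + 0} (λ _ → c)  ≡⟨ cong (X xor_) (trans (⨁-const-+ K 0 c) (xor-identityʳ X)) ⟩
  X xor X                     ≡⟨ xor-same X ⟩
  false                       ∎
  where
  open ≡-Reasoning
  X : Bool
  X = ⨁ {K} (λ _ → c)

⨁ⱽ : ∀ {n} → (V n → Bool) → Bool
⨁ⱽ {zero}  f = f []
⨁ⱽ {suc n} f = ⨁ⱽ (λ y → f (false ∷ y)) xor ⨁ⱽ (λ y → f (true ∷ y))

⨁ⱽ-cong : ∀ {n} {f g : V n → Bool} → (∀ y → f y ≡ g y) → ⨁ⱽ f ≡ ⨁ⱽ g
⨁ⱽ-cong {zero}  eq = eq []
⨁ⱽ-cong {suc n} eq = cong₂ _xor_ (⨁ⱽ-cong (λ y → eq (false ∷ y))) (⨁ⱽ-cong (λ y → eq (true ∷ y)))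

⨁ⱽ-xor : ∀ {n} (f g : V n → Bool) → ⨁ⱽ (λ y → f y xor g y) ≡ ⨁ⱽ f xor ⨁ⱽ g
⨁ⱽ-xor {zero}  f g = refl
⨁ⱽ-xor {suc n} f g =
  trans (cong₂ _xor_ (⨁ⱽ-xor (λ y → f (false ∷ y)) (λ y → g (false ∷ y)))
                     (⨁ⱽ-xor (λ y → f (true ∷ y)) (λ y → g (true ∷ y))))
        (xor-interchange (⨁ⱽ (λ y → f (false ∷ y))) (⨁ⱽ (λ y → g (false ∷ y)))
                         (⨁ⱽ (λ y → f (true ∷ y))) (⨁ⱽ (λ y → g (true ∷ y))))

⨁ⱽ-false : ∀ {n} → ⨁ⱽ {n} (λ _ → false) ≡ false
⨁ⱽ-false {zero}  = refl
⨁ⱽ-false {suc n} = cong₂ _xor_ (⨁ⱽ-false {n}) (⨁ⱽ-false {n})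

-- 𝔽₂^(n+1) has an even number of elements, so complementing does not change the sum
⨁ⱽ-not : ∀ {n} (f : V (suc n) → Bool) → ⨁ⱽ (λ y → not (f y)) ≡ ⨁ⱽ f
⨁ⱽ-not {zero}  f = xor-annihilates-not (f (false ∷ [])) (f (true ∷ []))
⨁ⱽ-not {suc n} f = cong₂ _xor_ (⨁ⱽ-not (λ y → f (false ∷ y))) (⨁ⱽ-not (λ y → f (true ∷ y)))

⨁ⱽ-sift : ∀ {n} (w : V n) (f : V n → Bool) → ⨁ⱽ (λ y → (w == y) ∧ f y) ≡ f w
⨁ⱽ-sift []          f = refl
⨁ⱽ-sift {suc n} (false ∷ w) f =
  trans (cong₂ _xor_ (⨁ⱽ-sift w (λ y → f (false ∷ y))) (⨁ⱽ-false {n}))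
        (xor-identityʳ (f (false ∷ w)))
⨁ⱽ-sift {suc n} (true ∷ w)  f =
  trans (cong (_xor ⨁ⱽ (λ y → (w == y) ∧ f (true ∷ y))) (⨁ⱽ-false {n}))
        (⨁ⱽ-sift w (λ y → f (true ∷ y)))

⨁ⱽ-swap : ∀ {n K} (g : Fin K → V n → Bool) → ⨁ⱽ (λ y → ⨁ (λ t → g t y)) ≡ ⨁ (λ t → ⨁ⱽ (g t))
⨁ⱽ-swap {n} {zero} g = ⨁ⱽ-false {n}
⨁ⱽ-swap {n} {suc K} g =
  trans (⨁ⱽ-xor (g zero) _) (cong (⨁ⱽ (g zero) xor_) (⨁ⱽ-swap (λ t → g (suc t))))

⨁ⱽ-remove : ∀ {n} (a : V n → Bool) (w : V n) → ⨁ⱽ (λ y → a y ∧ not (w == y)) ≡ ⨁ⱽ a xor a w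
⨁ⱽ-remove a w = begin
  ⨁ⱽ (λ y → a y ∧ not (w == y))        ≡⟨ ⨁ⱽ-cong (λ y → ∧-not (a y) (w == y)) ⟩
  ⨁ⱽ (λ y → a y xor ((w == y) ∧ a y))  ≡⟨ ⨁ⱽ-xor a _ ⟩
  ⨁ⱽ a xor ⨁ⱽ (λ y → (w == y) ∧ a y)   ≡⟨ cong (⨁ⱽ a xor_) (⨁ⱽ-sift w a) ⟩
  ⨁ⱽ a xor a w                          ∎
  where
  open ≡-Reasoning
  ∧-not : ∀ b c → b ∧ not c ≡ b xor (c ∧ b)
  ∧-not false false = refl
  ∧-not false true  = refl
  ∧-not true  false = refl
  ∧-not true  true  = refl

⨁ⱽ-witness : ∀ {n} (g : V n → Bool) → ⨁ⱽ g ≡ true → ∃ λ y → g y ≡ true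
⨁ⱽ-witness {zero}  g odd = [] , odd
⨁ⱽ-witness {suc n} g odd with ⨁ⱽ (λ y → g (false ∷ y)) in eq
... | true  = let (y , gy) = ⨁ⱽ-witness (λ y → g (false ∷ y)) eq in false ∷ y , gy
... | false = let (y , gy) = ⨁ⱽ-witness (λ y → g (true ∷ y)) odd in true ∷ y , gy

ΣV-⊕ : ∀ {m K} (f g : Fin K → V m) → ΣV (λ t → f t ⊕ g t) ≡ ΣV f ⊕ ΣV g
ΣV-⊕ {K = zero}  f g = sym (⊕-self 𝟎)
ΣV-⊕ {K = suc K} f g =
  trans (cong ((f zero ⊕ g zero) ⊕_) (ΣV-⊕ (λ t → f (suc t)) (λ t → g (suc t))))
        (⊕-interchange _ _ _ _)

ΣV-linear : ∀ {m m′ K} (L : V m → V m′) → Linear L → (f : Fin K → V m) →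
            ΣV (λ t → L (f t)) ≡ L (ΣV f)
ΣV-linear {K = zero}  L L-linear f = sym (linear-𝟎 L L-linear)
ΣV-linear {K = suc K} L L-linear f =
  trans (cong (L (f zero) ⊕_) (ΣV-linear L L-linear (λ t → f (suc t)))) (sym (L-linear _ _))

ΣV-· : ∀ {m K} (b : Fin K → Bool) (c : V m) → ΣV (λ t → b t · c) ≡ ⨁ b · c
ΣV-· {K = zero}  b c = refl
ΣV-· {K = suc K} b c =
  trans (cong (b zero · c ⊕_) (ΣV-· (λ t → b (suc t)) c)) (sym (·-xor (b zero) _ c))

-- Multiplicity parities of a family W : Fin K → 𝔽₂^n

parity : ∀ {n K} → (Fin K → V n) → V n → Bool
parity W y = ⨁ (λ t → W t == y)

⨁-parity : ∀ {n K} (W : Fin K → V n) (f : V n → Bool) →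
           ⨁ (λ t → f (W t)) ≡ ⨁ⱽ (λ y → parity W y ∧ f y)
⨁-parity W f = begin
  ⨁ (λ t → f (W t))                      ≡⟨ ⨁-cong (λ t → sym (⨁ⱽ-sift (W t) f)) ⟩
  ⨁ (λ t → ⨁ⱽ (λ y → (W t == y) ∧ f y))  ≡⟨ sym (⨁ⱽ-swap (λ t y → (W t == y) ∧ f y)) ⟩
  ⨁ⱽ (λ y → ⨁ (λ t → (W t == y) ∧ f y))  ≡⟨ ⨁ⱽ-cong (λ y → ⨁-∧ (λ t → W t == y) (f y)) ⟩
  ⨁ⱽ (λ y → parity W y ∧ f y)            ∎
  where open ≡-Reasoning

parity-even : ∀ {n} K (W : Fin (2 * K) → V n) → ⨁ⱽ (parity W) ≡ false
parity-even K W = begin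
  ⨁ⱽ (parity W)                   ≡⟨ ⨁ⱽ-cong (λ y → sym (∧-identityʳ (parity W y))) ⟩
  ⨁ⱽ (λ y → parity W y ∧ true)    ≡⟨ sym (⨁-parity W (λ _ → true)) ⟩
  ⨁ {2 * K} (λ _ → true)          ≡⟨ ⨁-const-even K true ⟩
  false                            ∎
  where open ≡-Reasoning

parity-𝟎 : ∀ {n K} (W : Fin K → V n) → (∀ t → W t ≢ 𝟎) → parity W 𝟎 ≡ false
parity-𝟎 {K = K} W W≢𝟎 = trans (⨁-cong (λ t → dec-false (W t ≟ⱽ 𝟎) (W≢𝟎 t))) (⨁-false {K})

-- Choice of the direction e

Balanced : ∀ {n K} → (Fin K → V n) → V n → Set
Balanced W e = (parity W e ≡ false × (ΣV W ≡ 𝟎 ⊎ ΣV W ≡ e))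
             ⊎ (parity W e ≡ true × ΣV W ≢ 𝟎 × ΣV W ≢ e)

∧-not-true : ∀ {a b} → a ∧ not b ≡ true → a ≡ true × b ≡ false
∧-not-true {true} {false} _ = refl , refl

even-nonzero : ∀ {n} K (W : Fin (2 * K) → V (suc n)) → (∀ t → W t ≢ 𝟎) →
               ∃ λ y → y ≢ 𝟎 × parity W y ≡ false
even-nonzero K W W≢𝟎 =
  let (y , good) = ⨁ⱽ-witness (λ y → not (parity W y) ∧ not (𝟎 == y)) odd
      (even , 𝟎≠y) = ∧-not-true good
  in y , (λ y≡𝟎 → ==-false 𝟎≠y (sym y≡𝟎)) , not-injective {y = false} even
  where
  -- there are 2^(n+1) - 1 nonzero vectors, an odd number, but ⨁ⱽ (parity W) = 0
  odd : ⨁ⱽ (λ y → not (parity W y) ∧ not (𝟎 == y)) ≡ true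
  odd = trans (⨁ⱽ-remove (λ y → not (parity W y)) 𝟎)
              (cong₂ _xor_ (trans (⨁ⱽ-not (parity W)) (parity-even K W))
                           (cong not (parity-𝟎 W W≢𝟎)))

odd-other : ∀ {n} K (W : Fin (2 * K) → V n) {w} → parity W w ≡ true →
            ∃ λ y → w ≢ y × parity W y ≡ true
odd-other K W {w} odd-w =
  let (y , good) = ⨁ⱽ-witness (λ y → parity W y ∧ not (w == y)) odd
      (odd-y , w≠y) = ∧-not-true good
  in y , ==-false w≠y , odd-y
  where
  odd : ⨁ⱽ (λ y → parity W y ∧ not (w == y)) ≡ true
  odd = trans (⨁ⱽ-remove (parity W) w) (cong₂ _xor_ (parity-even K W) odd-w)

odd⇒nonzero : ∀ {n K} (W : Fin K → V n) → (∀ t → W t ≢ 𝟎) → ∀ {y} → parity W y ≡ true → y ≢ 𝟎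
odd⇒nonzero W W≢𝟎 odd refl with trans (sym odd) (parity-𝟎 W W≢𝟎)
... | ()

balanced-direction : ∀ {n} K (W : Fin (2 * K) → V (suc n)) → (∀ t → W t ≢ 𝟎) →
                     ∃ λ e → e ≢ 𝟎 × Balanced W e
balanced-direction K W W≢𝟎 with ΣV W ≟ⱽ 𝟎
... | yes S≡𝟎 = let (y , y≢𝟎 , even) = even-nonzero K W W≢𝟎 in y , y≢𝟎 , inj₁ (even , inj₁ S≡𝟎)
... | no  S≢𝟎 with parity W (ΣV W) in parityS
...   | false = ΣV W , S≢𝟎 , inj₁ (parityS , inj₂ refl)
...   | true  = let (y , S≢y , odd) = odd-other K W parityS
                in y , odd⇒nonzero W W≢𝟎 odd , inj₂ (odd , S≢𝟎 , S≢y)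

-- A linear involution sending a nonzero e to u

detect : ∀ {m} (e : V m) → e ≢ 𝟎 → ∃ λ φ → LinearFunctional φ × φ e ≡ true
detect []          e≢𝟎 = ⊥-elim (e≢𝟎 refl)
detect (true ∷ e)  _   = head , (λ { (a ∷ x) (b ∷ y) → refl }) , refl
detect (false ∷ e) e≢𝟎 =
  let (φ , φ-linear , φe) = detect e (λ e≡𝟎 → e≢𝟎 (cong (false ∷_) e≡𝟎))
  in (λ x → φ (tail x)) , (λ x y → trans (cong φ (tail-⊕ x y)) (φ-linear _ _)) , φe

separate : ∀ {k} (e : V (suc k)) → e ≢ 𝟎 →
           ∃ λ φ → LinearFunctional φ × φ e ≡ true × φ unit ≡ true
separate (true ∷ e)  _   = head , (λ { (a ∷ x) (b ∷ y) → refl }) , refl , refl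
separate (false ∷ e) e≢𝟎 =
  let (φ , φ-linear , φe) = detect e (λ e≡𝟎 → e≢𝟎 (cong (false ∷_) e≡𝟎))
      ψ-linear : LinearFunctional (λ x → head x xor φ (tail x))
      ψ-linear = λ { (a ∷ x) (b ∷ y) →
        trans (cong ((a xor b) xor_) (φ-linear x y)) (xor-interchange a b _ _) }
  in (λ x → head x xor φ (tail x)) , ψ-linear , φe , cong (true xor_) (functional-𝟎 φ φ-linear)

module Transvection {m} (φ : V m → Bool) (φ-linear : LinearFunctional φ)
                    (d : V m) (φd≡false : φ d ≡ false) where
  open ≡-Reasoning

  τ : V m → V m
  τ x = x ⊕ φ x · d

  φ-multiple : ∀ b → φ (b · d) ≡ false
  φ-multiple true  = φd≡false
  φ-multiple false = functional-𝟎 φ φ-linear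

  φ-τ : ∀ x → φ (τ x) ≡ φ x
  φ-τ x = trans (φ-linear x _) (trans (cong (φ x xor_) (φ-multiple (φ x))) (xor-identityʳ (φ x)))

  τ-involutive : ∀ x → τ (τ x) ≡ x
  τ-involutive x = begin
    τ x ⊕ φ (τ x) · d          ≡⟨ cong (λ b → τ x ⊕ b · d) (φ-τ x) ⟩
    (x ⊕ φ x · d) ⊕ φ x · d    ≡⟨ ⊕-assoc x _ _ ⟩
    x ⊕ (φ x · d ⊕ φ x · d)    ≡⟨ cong (x ⊕_) (⊕-self _) ⟩
    x ⊕ 𝟎                      ≡⟨ ⊕-identityʳ x ⟩
    x                          ∎

  τ-linear : Linear τ
  τ-linear x y = begin
    (x ⊕ y) ⊕ φ (x ⊕ y) · d            ≡⟨ cong (λ b → (x ⊕ y) ⊕ b · d) (φ-linear x y) ⟩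
    (x ⊕ y) ⊕ (φ x xor φ y) · d        ≡⟨ cong ((x ⊕ y) ⊕_) (·-xor (φ x) (φ y) d) ⟩
    (x ⊕ y) ⊕ (φ x · d ⊕ φ y · d)      ≡⟨ ⊕-interchange x y _ _ ⟩
    τ x ⊕ τ y                          ∎

record Involution {k} (e : V (suc k)) : Set where
  field
    T            : V (suc k) → V (suc k)
    T-involutive : ∀ x → T (T x) ≡ x
    T-linear     : Linear T
    T-e          : T e ≡ unit

involution : ∀ {k} (e : V (suc k)) → e ≢ 𝟎 → Involution e
involution {k} e e≢𝟎 with separate e e≢𝟎
... | φ , φ-linear , φe≡true , φu≡true = record
  { T = τ ; T-involutive = τ-involutive ; T-linear = τ-linear ; T-e = τ-e }
  where
  -- the transvection along d = e + u swaps e and u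
  d : V (suc k)
  d = e ⊕ unit
  φd≡false : φ d ≡ false
  φd≡false = trans (φ-linear e unit) (cong₂ _xor_ φe≡true φu≡true)
  open Transvection φ φ-linear d φd≡false
  τ-e : τ e ≡ unit
  τ-e = trans (cong (λ b → e ⊕ b · d) φe≡true) (⊕-cancelˡ e unit)

module Projection {k} {e : V (suc k)} (𝒯 : Involution e) where
  open Involution 𝒯

  π : V (suc k) → V k
  π y = tail (T y)

  π-linear : Linear π
  π-linear x y = trans (cong tail (T-linear x y)) (tail-⊕ (T x) (T y))

  π-zero : ∀ y → y ≡ 𝟎 ⊎ y ≡ e → π y ≡ 𝟎
  π-zero _ (inj₁ refl) = cong tail (linear-𝟎 T T-linear)
  π-zero _ (inj₂ refl) = cong tail T-e

  π-kernel : ∀ y → π y ≡ 𝟎 → y ≡ 𝟎 ⊎ y ≡ e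
  π-kernel y πy≡𝟎 = Sum.map (preimage (linear-𝟎 T T-linear)) (preimage T-unit) (tail≡𝟎 (T y) πy≡𝟎)
    where
    preimage : ∀ {z w} → T z ≡ w → T y ≡ z → y ≡ w
    preimage Tz≡w Ty≡z = trans (sym (T-involutive y)) (trans (cong T Ty≡z) Tz≡w)
    T-unit : T unit ≡ e
    T-unit = trans (cong T (sym T-e)) (T-involutive e)

  reduced : ∀ {K} → (Fin K → V (suc k)) → V k → Fin K → V k
  reduced W c t = π (W t) ⊕ (W t == e) · c

  reduced-lifts : ∀ {K} (W : Fin K → V (suc k)) c t →
                  T (W t) ≡ unit ⊎ tail (T (W t)) ≡ reduced W c t
  reduced-lifts W c t with W t ≟ⱽ e
  ... | yes Wt≡e = inj₁ (trans (cong T Wt≡e) T-e)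
  ... | no  _    = inj₂ (sym (⊕-identityʳ (π (W t))))

  reduced-nonzero : ∀ {K} (W : Fin K → V (suc k)) {c} → (∀ t → W t ≢ 𝟎) → c ≢ 𝟎 →
                    ∀ t → reduced W c t ≢ 𝟎
  reduced-nonzero W {c} W≢𝟎 c≢𝟎 t with W t ≟ⱽ e
  ... | yes Wt≡e = λ x≡𝟎 → c≢𝟎 (begin
    c              ≡⟨ sym (⊕-identityˡ c) ⟩
    𝟎 ⊕ c          ≡⟨ cong (_⊕ c) (sym (π-zero (W t) (inj₂ Wt≡e))) ⟩
    π (W t) ⊕ c    ≡⟨ x≡𝟎 ⟩
    𝟎              ∎)
    where open ≡-Reasoning
  ... | no  Wt≢e = λ x≡𝟎 → [ W≢𝟎 t , Wt≢e ]′ (π-kernel (W t) (trans (sym (⊕-identityʳ _)) x≡𝟎))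

  reduced-sum : ∀ {K} (W : Fin K → V (suc k)) c → ΣV (reduced W c) ≡ π (ΣV W) ⊕ parity W e · c
  reduced-sum W c =
    trans (ΣV-⊕ (λ t → π (W t)) (λ t → (W t == e) · c))
          (cong₂ _⊕_ (ΣV-linear π π-linear W) (ΣV-· (λ t → W t == e) c))

correction : ∀ {k K} {e : V (suc (suc k))} (𝒯 : Involution e) (W : Fin K → V (suc (suc k))) →
             Balanced W e → ∃ λ c → c ≢ 𝟎 × ΣV (Projection.reduced 𝒯 W c) ≡ 𝟎
correction 𝒯 W (inj₁ (even , S∈𝟎e)) =
  unit , (λ ()) , trans (reduced-sum W unit)
                        (trans (cong₂ (λ a b → a ⊕ b · unit) (π-zero (ΣV W) S∈𝟎e) even) (⊕-self 𝟎))
  where open Projection 𝒯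
correction 𝒯 W (inj₂ (odd , S≢𝟎 , S≢e)) =
  π (ΣV W) , (λ πS≡𝟎 → [ S≢𝟎 , S≢e ]′ (π-kernel (ΣV W) πS≡𝟎))
           , trans (reduced-sum W (π (ΣV W)))
                   (trans (cong (λ b → π (ΣV W) ⊕ b · π (ΣV W)) odd) (⊕-self (π (ΣV W))))
  where open Projection 𝒯

Decomposition : ∀ {m} {I : Set} → (I → V m) → Set
Decomposition {m} {I} x =
  ∃₂ λ (p q : I → V m) → Bijective _≡_ _≡_ [ p , q ] × (∀ i → p i ⊕ q i ≡ x i)

↔⇒bijective : ∀ {A B : Set} (F : A ↔ B) {f : A → B} → (∀ a → Inverse.to F a ≡ f a) →
              Bijective _≡_ _≡_ f
↔⇒bijective F {f} to≗f = Bijection.bijective (↔⇒⤖ (mk↔ₛ′ f from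
  (λ y → trans (sym (to≗f (from y))) (strictlyInverseˡ y))
  (λ a → trans (cong from (sym (to≗f a))) (strictlyInverseʳ a))))
  where open Inverse F

involution-↔ : ∀ {A : Set} (f : A → A) → (∀ a → f (f a) ≡ a) → A ↔ A
involution-↔ f f∘f≗id = mk↔ₛ′ f f f∘f≗id f∘f≗id

transport : ∀ {m m′} {I J : Set} {x : I → V m} {y : J → V m′}
            (φ : J ↔ I) (T : V m ↔ V m′) → Linear (Inverse.to T) →
            (∀ j → Inverse.to T (x (Inverse.to φ j)) ≡ y j) →
            Decomposition x → Decomposition y
transport {m′ = m′} {J = J} {y = y} φ T T-linear T∘x≗y (p , q , pq-bijective , p⊕q≗x) =
  p′ , q′ , ↔⇒bijective composite (λ { (inj₁ j) → refl ; (inj₂ j) → refl }) , sums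
  where
  open Inverse using (to)
  p′ q′ : J → V m′
  p′ j = to T (p (to φ j))
  q′ j = to T (q (to φ j))
  composite : (J ⊎ J) ↔ V m′
  composite = ↔-trans (φ ⊎-↔ φ) (↔-trans (⤖⇒↔ (mk⤖ pq-bijective)) T)
  sums : ∀ j → p′ j ⊕ q′ j ≡ y j
  sums j = trans (sym (T-linear _ _)) (trans (cong (to T) (p⊕q≗x (to φ j))) (T∘x≗y j))

-- Doubling: from a decomposition of x to one of the pairs (w i, w i)

pick : ∀ {A : Set} → Bool → A → A ⊎ A
pick false = inj₁
pick true  = inj₂

label : ∀ {A : Set} → A ⊎ A → A × Bool
label (inj₁ a) = a , false
label (inj₂ a) = a , true

pick-label : ∀ {A : Set} (σ : A ⊎ A) → pick (proj₂ (label σ)) (proj₁ (label σ)) ≡ σ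
pick-label (inj₁ a) = refl
pick-label (inj₂ a) = refl

label-pick : ∀ {A : Set} s (a : A) → label (pick s a) ≡ (a , s)
label-pick false a = refl
label-pick true  a = refl

xor-cancelˡ : ∀ a b → a xor (a xor b) ≡ b
xor-cancelˡ false b = refl
xor-cancelˡ true  b = not-involutive b

-- If each w i is either u or a lift of x i, the four vectors (a, p i), (a, q i)
-- can be regrouped into two pairs summing to w i.  Bijectivity is seen by
-- factoring through I × (side, bit), on which the regrouping is an involution
-- of each fibre.
module Doubling {k} {I : Set} {x : I → V k} (w : I → V (suc k))
                (lifts : ∀ i → w i ≡ unit ⊎ tail (w i) ≡ x i)
                (p q : I → V k) (pq-bijective : Bijective _≡_ _≡_ [ p , q ])
                (p⊕q≗x : ∀ i → p i ⊕ q i ≡ x i) where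
  open Inverse (⤖⇒↔ (mk⤖ pq-bijective)) using (from; strictlyInverseˡ; strictlyInverseʳ)

  point : I × (Bool × Bool) → V (suc k)
  point (i , s , a) = a ∷ [ p , q ] (pick s i)

  point-↔ : (I × (Bool × Bool)) ↔ V (suc k)
  point-↔ = mk↔ₛ′ point unpoint point∘unpoint unpoint∘point
    where
    unpoint : V (suc k) → I × (Bool × Bool)
    unpoint (a ∷ y) = proj₁ (label (from y)) , proj₂ (label (from y)) , a
    point∘unpoint : ∀ y → point (unpoint y) ≡ y
    point∘unpoint (a ∷ y) =
      cong (a ∷_) (trans (cong [ p , q ] (pick-label (from y))) (strictlyInverseˡ y))
    unpoint∘point : ∀ z → unpoint (point z) ≡ z
    unpoint∘point (i , s , a) =
      cong (λ l → proj₁ l , proj₂ l , a)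
           (trans (cong label (strictlyInverseʳ (pick s i))) (label-pick s i))

  -- a new pair (s-th member of pair (i, b)) is indexed by (i, s, b)
  split-↔ : ((I × Bool) ⊎ (I × Bool)) ↔ (I × (Bool × Bool))
  split-↔ = mk↔ₛ′ split unsplit split∘unsplit unsplit∘split
    where
    split : (I × Bool) ⊎ (I × Bool) → I × (Bool × Bool)
    split σ = proj₁ (proj₁ (label σ)) , proj₂ (label σ) , proj₂ (proj₁ (label σ))
    unsplit : I × (Bool × Bool) → (I × Bool) ⊎ (I × Bool)
    unsplit (i , s , b) = pick s (i , b)
    split∘unsplit : ∀ z → split (unsplit z) ≡ z
    split∘unsplit (i , false , b) = refl
    split∘unsplit (i , true  , b) = refl
    unsplit∘split : ∀ σ → unsplit (split σ) ≡ σ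
    unsplit∘split (inj₁ _) = refl
    unsplit∘split (inj₂ _) = refl

  -- the regrouping inside the fibre over i: (s, b) ↦ (side, head)
  β : ∀ i → w i ≡ unit ⊎ tail (w i) ≡ x i → Bool × Bool → Bool × Bool
  β i (inj₁ _) (s , b) = b , s
  β i (inj₂ _) (s , b) = s , (s ∧ head (w i)) xor b

  β-involutive : ∀ i h z → β i h (β i h z) ≡ z
  β-involutive i (inj₁ _) (s , b) = refl
  β-involutive i (inj₂ _) (s , b) = cong (s ,_) (xor-cancelˡ (s ∧ head (w i)) b)

  fibre-↔ : (I × (Bool × Bool)) ↔ (I × (Bool × Bool))
  fibre-↔ = involution-↔ (λ (i , z) → i , β i (lifts i) z)
                         (λ (i , z) → cong (i ,_) (β-involutive i (lifts i) z))

  P Q : I × Bool → V (suc k)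
  P (i , b) = point (i , β i (lifts i) (false , b))
  Q (i , b) = point (i , β i (lifts i) (true , b))

  P⊕Q : ∀ i b → P (i , b) ⊕ Q (i , b) ≡ w i
  P⊕Q i b = pair-sum (lifts i)
    where
    pair-sum : (h : w i ≡ unit ⊎ tail (w i) ≡ x i) →
               point (i , β i h (false , b)) ⊕ point (i , β i h (true , b)) ≡ w i
    pair-sum (inj₁ w≡u)    = trans (cong (true ∷_) (⊕-self ([ p , q ] (pick b i)))) (sym w≡u)
    pair-sum (inj₂ tail≡x) =
      trans (cong₂ _∷_ (trans (cong (b xor_) (xor-comm (head (w i)) b))
                              (xor-cancelˡ b (head (w i))))
                       (trans (p⊕q≗x i) (sym tail≡x)))
            (head-∷-tail (w i))

  decomposition : Decomposition (λ (ib : I × Bool) → w (proj₁ ib))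
  decomposition =
    P , Q , ↔⇒bijective (↔-trans split-↔ (↔-trans fibre-↔ point-↔))
                        (λ { (inj₁ _) → refl ; (inj₂ _) → refl })
          , λ (i , b) → P⊕Q i b

double : ∀ {k} {I : Set} {x : I → V k} (w : I → V (suc k)) →
         (∀ i → w i ≡ unit ⊎ tail (w i) ≡ x i) →
         Decomposition x → Decomposition (λ (ib : I × Bool) → w (proj₁ ib))
double w lifts (p , q , pq-bijective , p⊕q≗x) =
  Doubling.decomposition w lifts p q pq-bijective p⊕q≗x

-- Consecutive pairs of indices: Fin (2K) ≅ Fin K × Bool, i = 2t + b

cast-↔ : ∀ {m n} → m ≡ n → Fin m ↔ Fin n
cast-↔ eq =
  mk↔ₛ′ (cast eq) (cast (sym eq)) (cast-involutive eq (sym eq)) (cast-involutive (sym eq) eq)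

halve : ∀ K → Fin (2 * K) ↔ (Fin K × Bool)
halve K = ↔-trans (cast-↔ (*-comm 2 K)) (↔-trans *↔× (↔-refl ×-↔ 2↔Bool))

pairIndex : ∀ {K} → Fin K → Bool → Fin (2 * K)
pairIndex {K} t b = Inverse.from (halve K) (t , b)

toℕ-pairIndex-false : ∀ {K} (t : Fin K) → toℕ (pairIndex t false) ≡ 2 * toℕ t
toℕ-pairIndex-false {K} t =
  trans (toℕ-cast (sym (*-comm 2 K)) (combine t zero)) (trans (toℕ-combine t zero) (+-identityʳ _))

toℕ-pairIndex-true : ∀ {K} (t : Fin K) → toℕ (pairIndex t true) ≡ suc (2 * toℕ t)
toℕ-pairIndex-true {K} t =
  trans (toℕ-cast (sym (*-comm 2 K)) (combine t (suc zero)))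
        (trans (toℕ-combine t (suc zero)) (+-comm _ 1))

Paired : ∀ {A : Set} K → (Fin (2 * K) → A) → Set
Paired K v = ∀ (t : ℕ) (i j : Fin (2 * K)) → toℕ i ≡ 2 * t → toℕ j ≡ suc (2 * t) → v i ≡ v j

pairValues : ∀ {A : Set} K → (Fin (2 * K) → A) → Fin K → A
pairValues K v t = v (pairIndex t false)

paired-halve : ∀ {A : Set} K {v : Fin (2 * K) → A} → Paired K v →
               ∀ i → v i ≡ pairValues K v (proj₁ (Inverse.to (halve K) i))
paired-halve K {v} pairs i =
  trans (cong v (sym (strictlyInverseʳ i))) (first-of-pair (to i))
  where
  open Inverse (halve K)
  first-of-pair : ∀ tb → v (from tb) ≡ pairValues K v (proj₁ tb)
  first-of-pair (t , false) = refl
  first-of-pair (t , true)  =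
    sym (pairs (toℕ t) (pairIndex t false) (pairIndex t true)
               (toℕ-pairIndex-false t) (toℕ-pairIndex-true t))

reduction : ∀ {k} K (v : Fin (2 * K) → V (suc k)) → Paired K v →
            ∀ {e} (𝒯 : Involution e) (c : V k) →
            Decomposition (Projection.reduced 𝒯 (pairValues K v) c) → Decomposition v
reduction K v pairs 𝒯 c reducedDecomposition =
  transport (halve K) (involution-↔ T T-involutive) T-linear
            (λ i → trans (T-involutive _) (sym (paired-halve K pairs i)))
            (double (λ t → T (pairValues K v t)) (reduced-lifts (pairValues K v) c)
                    reducedDecomposition)
  where
  open Involution 𝒯
  open Projection 𝒯

single-decomposition : (x : Fin 1 → V 1) → x zero ≡ true ∷ [] → Decomposition x
single-decomposition x x₀≡1 =
  (λ _ → false ∷ []) , (λ _ → true ∷ [])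
  , ↔⇒bijective 𝔽₂¹-↔ (λ { (inj₁ zero) → refl ; (inj₂ zero) → refl })
  , λ { zero → sym x₀≡1 }
  where
  𝔽₂¹-↔ : (Fin 1 ⊎ Fin 1) ↔ V 1
  𝔽₂¹-↔ = mk↔ₛ′ [ (λ _ → false ∷ []) , (λ _ → true ∷ []) ]
                 (λ { (false ∷ []) → inj₁ zero ; (true ∷ []) → inj₂ zero })
                 (λ { (false ∷ []) → refl ; (true ∷ []) → refl })
                 (λ { (inj₁ zero) → refl ; (inj₂ zero) → refl })

proposition8 : (n : ℕ) → 2 ≤ n →
    ((x : Fin (2 ^ (n ∸ 2)) → V (n ∸ 1)) →
      (∀ i → x i ≢ 𝟎) → ΣV x ≡ 𝟎 → PairDecomposition x) →
    (v : Fin (2 ^ (n ∸ 1)) → V n) →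
      (∀ i → v i ≢ 𝟎) →
      (∀ (t : ℕ) (i j : Fin (2 ^ (n ∸ 1))) → toℕ i ≡ 2 * t → toℕ j ≡ suc (2 * t) → v i ≡ v j) →
      PairDecomposition v
-- n = 2: a single pair; the reduced family is the vector 1 ∈ 𝔽₂¹
proposition8 (suc (suc zero)) (s≤s (s≤s z≤n)) _ v v≢𝟎 pairs =
  reduction 1 v pairs 𝒯 (true ∷ []) (single-decomposition _ x₀≡1)
  where
  W : Fin 1 → V 2
  W = pairValues 1 v
  𝒯 : Involution (W zero)
  𝒯 = involution (W zero) (v≢𝟎 _)
  open Projection 𝒯
  x₀≡1 : reduced W (true ∷ []) zero ≡ true ∷ []
  x₀≡1 = cong₂ (λ a b → a ⊕ b · (true ∷ [])) (π-zero (W zero) (inj₂ refl)) (==-refl (W zero))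
proposition8 (suc (suc (suc m))) (s≤s (s≤s z≤n)) H v v≢𝟎 pairs =
  let (e , e≢𝟎 , balanced) = balanced-direction (2 ^ m) W W≢𝟎
      𝒯 = involution e e≢𝟎
      (c , c≢𝟎 , Σx≡𝟎) = correction 𝒯 W balanced
  in reduction (2 ^ suc m) v pairs 𝒯 c
       (H (Projection.reduced 𝒯 W c) (Projection.reduced-nonzero 𝒯 W W≢𝟎 c≢𝟎) Σx≡𝟎)
  where
  W : Fin (2 ^ suc m) → V (suc (suc (suc m)))
  W = pairValues (2 ^ suc m) v
  W≢𝟎 : ∀ t → W t ≢ 𝟎
  W≢𝟎 t = v≢𝟎 _
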